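{- Let $(L,Q_1,Q_2,R)$ be a $(4,3)$-flexipath (with exactly $n=2$ internal steps) in a matroid $M$. Then there is $N\in\{M,M^*\}$ such that, for each $i\in\{1,2\}$, $(\sqcap_N(L,Q_i),\sqcap^*_N(L,Q_i))=(2,1)$.
   Context: For a matroid $N$ on ground set $E$ with rank function $r$: $\lambda(A)=r(A)+r(E-A)-r(N)$; for disjoint $X,Y$, $\sqcap_N(X,Y)=r(X)+r(Y)-r(X\cup Y)$ and $\sqcap^*_N(X,Y)=\sqcap_{N^*}(X,Y)$; $\kappa(X,Y)=\min\{\lambda(Z):X\subseteq Z\subseteq E-Y\}$. A path of $4$-separations in $M$ is an ordered partition $(L,P_1,\ldots,P_n,R)$ of $E(M)$ with $\kappa(L,R)=3$ and $\lambda(L\cup P_1\cup\cdots\cup P_i)=3$ for all $i\in\{0,\ldots,n\}$; a $4$-flexipath if this holds for every reordering of $P_1,\ldots,P_n$ (with $L,R$ fixed); a $(4,c)$-flexipath if moreover $\lambda(P_i)=c$ for all $i$ and $\lambda(P_i\cup P_j)>c$ for all distinct $i,j$. -}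

module Defs where

open import Data.Nat using (ℕ; _+_; _∸_; _≤_; _<_)
open import Data.Fin.Subset using (Subset; _∪_; _∩_; ∁; ⊥; ⊤; _⊆_; ∣_∣)
open import Data.Product using (_×_; Σ)
open import Relation.Binary.PropositionalEquality using (_≡_)

record Matroid (n : ℕ) : Set where
  field
    rank      : Subset n → ℕ
    rank-card : ∀ X → rank X ≤ ∣ X ∣
    rank-mono : ∀ {X Y} → X ⊆ Y → rank X ≤ rank Y
    rank-sub  : ∀ X Y → rank (X ∪ Y) + rank (X ∩ Y) ≤ rank X + rank Y
open Matroid public

RankFn : ℕ → Set
RankFn n = Subset n → ℕ

dualRank : ∀ {n} → RankFn n → RankFn n
dualRank r X = (∣ X ∣ + r (∁ X)) ∸ r ⊤

conn : ∀ {n} → RankFn n → Subset n → ℕ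
conn r A = (r A + r (∁ A)) ∸ r ⊤

localConn : ∀ {n} → RankFn n → Subset n → Subset n → ℕ
localConn r X Y = (r X + r Y) ∸ r (X ∪ Y)

IsKappa : ∀ {n} → RankFn n → Subset n → Subset n → ℕ → Set
IsKappa {n} r X Y k =
  Σ (Subset n) (λ Z → X ⊆ Z × Z ⊆ ∁ Y × conn r Z ≡ k)
  × (∀ Z → X ⊆ Z → Z ⊆ ∁ Y → k ≤ conn r Z)

Partition4 : ∀ {n} → Subset n → Subset n → Subset n → Subset n → Set
Partition4 L Q₁ Q₂ R =
  (L ∩ Q₁ ≡ ⊥) × (L ∩ Q₂ ≡ ⊥) × (L ∩ R ≡ ⊥)
  × (Q₁ ∩ Q₂ ≡ ⊥) × (Q₁ ∩ R ≡ ⊥) × (Q₂ ∩ R ≡ ⊥)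
  × (L ∪ Q₁ ∪ Q₂ ∪ R ≡ ⊤)

PathOf4Seps : ∀ {n} → Matroid n → Subset n → Subset n → Subset n → Subset n → Set
PathOf4Seps M L P₁ P₂ R =
  Partition4 L P₁ P₂ R × IsKappa (rank M) L R 3
  × conn (rank M) L ≡ 3 × conn (rank M) (L ∪ P₁) ≡ 3
  × conn (rank M) (L ∪ P₁ ∪ P₂) ≡ 3

FlexiPath4 : ∀ {n} → Matroid n → Subset n → Subset n → Subset n → Subset n → Set
FlexiPath4 M L Q₁ Q₂ R = PathOf4Seps M L Q₁ Q₂ R × PathOf4Seps M L Q₂ Q₁ R

FlexiPath4c : ∀ {n} → ℕ → Matroid n → Subset n → Subset n → Subset n → Subset n → Set
FlexiPath4c c M L Q₁ Q₂ R =
  FlexiPath4 M L Q₁ Q₂ R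
  × conn (rank M) Q₁ ≡ c × conn (rank M) Q₂ ≡ c
  × c < conn (rank M) (Q₁ ∪ Q₂)

Pair21 : ∀ {n} → RankFn n → Subset n → Subset n → Set
Pair21 r L Q = localConn r L Q ≡ 2 × localConn (dualRank r) L Q ≡ 1

{-# OPTIONS --safe #-}
-- Restrict the rank function to unions of the blocks L, Q₁, Q₂, R: a monotone submodular
-- function on the subsets of a 4-element set. Write α = ⊓(L,Q₁) and β = ⊓(L,Q₂). The chain rule
-- ⊓(X,Y) + ⊓(X∪Y,Z) = ⊓(X,Y∪Z) + ⊓(Y,Z) applied with λ(Q₁) = λ(L∪Q₁) = 3 gives
-- ⊓(L,Q₂∪R) = α, so β ≤ α by monotonicity of ⊓; symmetrically α = β. Chaining through R in
-- the same way, λ(Q₁∪Q₂) ≥ 4 forces 4 ≤ 3 + 2α and 2α + 4 ≤ 9, hence α ∈ {1,2}. Finally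
-- ⊓(L,Qᵢ) + ⊓*(L,Qᵢ) = λ(L) + λ(Qᵢ) − λ(L∪Qᵢ) = 3, so α = 2 gives the pair (2,1) in M and
-- α = 1 gives it in M*.
module Submission where

open import Defs
open import Data.Nat using (ℕ)
open import Data.Fin.Subset using (Subset)
open import Data.Product using (_×_)
open import Data.Sum using (_⊎_)

open import Data.Nat using (suc; _+_; _∸_; _≤_; _<_; s≤s)
open import Data.Nat.Properties
open import Algebra.Properties.CommutativeSemigroup +-commutativeSemigroup using (xy∙z≈xz∙y)
open import Data.Nat.Tactic.RingSolver using (solve)
open import Data.Bool using (true; false; _∧_; _∨_; not)
open import Data.Fin using (Fin; zero; suc)
open import Data.Fin.Subset using (_∪_; _∩_; ∁; ⊥; ⊤; ⁅_⁆; ∣_∣)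
open import Data.Fin.Subset.Properties
  using (p⊆p∪q; p∪∁p≡⊤; ∣⊥∣≡0; ∣⊤∣≡n; ∣∁p∣≡n∸∣p∣; ∣p∣≤n; ∪-assoc; ∪-comm; ∪-idem; ∪-distribˡ-∩; ∪-∩-booleanAlgebra)
import Algebra.Lattice.Properties.BooleanAlgebra as BooleanAlgebraProperties
open import Data.Vec using (Vec; map; lookup)
open import Data.Vec.Properties using (lookup-zipWith; lookup-map; lookup-replicate; ∷-injectiveˡ; ∷-injectiveʳ)
open import Data.Product using (Σ-syntax; _,_)
open import Data.Sum using (inj₁; inj₂)
import Data.Sum as Sum
open import Relation.Nullary using (contradiction)
open import Relation.Binary.PropositionalEquality

-- List and Vec constructors are opened in separate modules: with both in scope, the ring
-- solver's (overloaded) variable lists take minutes to elaborate.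
module _ where
  open import Data.List using ([]; _∷_)

  chain-arithmetic : ∀ {p q s t : ℕ} x y z xy yz xyz → p + xy ≡ x + y → q + xyz ≡ xy + z →
    s + xyz ≡ x + yz → t + yz ≡ y + z → p + q ≡ s + t
  chain-arithmetic {p} {q} {s} {t} x y z xy yz xyz p+ q+ s+ t+ =
    +-cancelʳ-≡ (xy + (xyz + yz)) (p + q) (s + t) (begin
      (p + q) + (xy + (xyz + yz))  ≡⟨ solve (p ∷ q ∷ xy ∷ xyz ∷ yz ∷ []) ⟩
      (p + xy) + (q + xyz) + yz    ≡⟨ cong₂ (λ u v → u + v + yz) p+ q+ ⟩
      (x + y) + (xy + z) + yz      ≡⟨ solve (x ∷ y ∷ z ∷ xy ∷ yz ∷ []) ⟩
      (x + yz) + (y + z) + xy      ≡⟨ cong₂ (λ u v → u + v + xy) (sym s+) (sym t+) ⟩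
      (s + xyz) + (t + yz) + xy    ≡⟨ solve (s ∷ t ∷ xy ∷ xyz ∷ yz ∷ []) ⟩
      (s + t) + (xy + (xyz + yz))  ∎)
    where open ≡-Reasoning

  mono-arithmetic : ∀ {p s : ℕ} x y xy yz xyz → p + xy ≡ x + y → s + xyz ≡ x + yz →
    xyz + y ≤ xy + yz → p ≤ s
  mono-arithmetic {p} {s} x y xy yz xyz p+ s+ sub =
    +-cancelʳ-≤ (xyz + y) p s (begin
      p + (xyz + y)   ≤⟨ +-monoʳ-≤ p sub ⟩
      p + (xy + yz)   ≡⟨ sym (+-assoc p xy yz) ⟩
      (p + xy) + yz   ≡⟨ cong (_+ yz) p+ ⟩
      (x + y) + yz    ≡⟨ solve (x ∷ y ∷ yz ∷ []) ⟩
      (x + yz) + y    ≡⟨ cong (_+ y) (sym s+) ⟩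
      (s + xyz) + y   ≡⟨ +-assoc s xyz y ⟩
      s + (xyz + y)   ∎)
    where open ≤-Reasoning

  dual-arithmetic : ∀ {p k} rx ry rxy sx sy sxy lx ly lxy cx cy →
    p + rxy ≡ rx + ry → lx + cx ≡ rx + sx → ly + cy ≡ ry + sy → lxy + (cx + cy) ≡ rxy + sxy →
    p + k + lxy ≡ lx + ly → sx + sy ≡ k + sxy
  dual-arithmetic {p} {k} rx ry rxy sx sy sxy lx ly lxy cx cy p+ x+ y+ xy+ sum =
    +-cancelʳ-≡ (rx + ry) (sx + sy) (k + sxy) (begin
      (sx + sy) + (rx + ry)                ≡⟨ solve (sx ∷ sy ∷ rx ∷ ry ∷ []) ⟩
      (rx + sx) + (ry + sy)                ≡⟨ cong₂ _+_ x+ y+ ⟨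
      (lx + cx) + (ly + cy)                ≡⟨ solve (lx ∷ ly ∷ cx ∷ cy ∷ []) ⟩
      (lx + ly) + (cx + cy)                ≡⟨ cong (_+ (cx + cy)) sum ⟨
      (p + k + lxy) + (cx + cy)            ≡⟨ solve (p ∷ k ∷ lxy ∷ cx ∷ cy ∷ []) ⟩
      k + p + (lxy + (cx + cy))            ≡⟨ cong (k + p +_) xy+ ⟩
      k + p + (rxy + sxy)                  ≡⟨ solve (k ∷ p ∷ rxy ∷ sxy ∷ []) ⟩
      (k + sxy) + (p + rxy)                ≡⟨ cong ((k + sxy) +_) p+ ⟩
      (k + sxy) + (rx + ry)                ∎)
    where open ≡-Reasoning

module LocalConnectivity {k : ℕ} (ρ : Subset k → ℕ)
  (ρ-mono : ∀ S T → ρ S ≤ ρ (S ∪ T))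
  (ρ-submod : ∀ S T → ρ (S ∪ T) + ρ (S ∩ T) ≤ ρ S + ρ T) where

  localConn-+ : ∀ S T → localConn ρ S T + ρ (S ∪ T) ≡ ρ S + ρ T
  localConn-+ S T = m∸n+n≡m (≤-trans (m≤m+n (ρ (S ∪ T)) (ρ (S ∩ T))) (ρ-submod S T))

  conn-+ : ∀ S → conn ρ S + ρ ⊤ ≡ ρ S + ρ (∁ S)
  conn-+ S = subst (λ X → (ρ S + ρ (∁ S)) ∸ ρ X + ρ X ≡ ρ S + ρ (∁ S)) (p∪∁p≡⊤ S)
    (localConn-+ S (∁ S))

  localConn-comm : ∀ S T → localConn ρ S T ≡ localConn ρ T S
  localConn-comm S T = cong₂ _∸_ (+-comm (ρ S) (ρ T)) (cong ρ (∪-comm S T))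

  localConn-chain : ∀ S T U →
    localConn ρ S T + localConn ρ (S ∪ T) U ≡ localConn ρ S (T ∪ U) + localConn ρ T U
  localConn-chain S T U = chain-arithmetic (ρ S) (ρ T) (ρ U) (ρ (S ∪ T)) (ρ (T ∪ U)) (ρ (S ∪ T ∪ U))
    (localConn-+ S T)
    (subst (λ X → localConn ρ (S ∪ T) U + ρ X ≡ ρ (S ∪ T) + ρ U) (∪-assoc S T U) (localConn-+ (S ∪ T) U))
    (localConn-+ S (T ∪ U)) (localConn-+ T U)

  localConn-chain-cancel : ∀ S T U →
    localConn ρ S (T ∪ U) ≡ localConn ρ (S ∪ T) U → localConn ρ S T ≡ localConn ρ T U
  localConn-chain-cancel S T U eq = +-cancelʳ-≡ (localConn ρ (S ∪ T) U) _ _ (begin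
    localConn ρ S T + localConn ρ (S ∪ T) U   ≡⟨ localConn-chain S T U ⟩
    localConn ρ S (T ∪ U) + localConn ρ T U   ≡⟨ cong (_+ localConn ρ T U) eq ⟩
    localConn ρ (S ∪ T) U + localConn ρ T U   ≡⟨ +-comm (localConn ρ (S ∪ T) U) (localConn ρ T U) ⟩
    localConn ρ T U + localConn ρ (S ∪ T) U   ∎)
    where open ≡-Reasoning

  localConn-monoʳ : ∀ S T U → localConn ρ S T ≤ localConn ρ S (T ∪ U)
  localConn-monoʳ S T U = mono-arithmetic (ρ S) (ρ T) (ρ (S ∪ T)) (ρ (T ∪ U)) (ρ (S ∪ T ∪ U))
    (localConn-+ S T) (localConn-+ S (T ∪ U)) (begin
    ρ (S ∪ T ∪ U) + ρ T                    ≤⟨ +-monoʳ-≤ (ρ (S ∪ T ∪ U)) (ρ-mono T (S ∩ U)) ⟩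
    ρ (S ∪ T ∪ U) + ρ (T ∪ S ∩ U)          ≡⟨ cong₂ (λ X Y → ρ X + ρ Y) union meet ⟩
    ρ ((S ∪ T) ∪ (T ∪ U)) + ρ ((S ∪ T) ∩ (T ∪ U))  ≤⟨ ρ-submod (S ∪ T) (T ∪ U) ⟩
    ρ (S ∪ T) + ρ (T ∪ U)                  ∎)
    where
    open ≤-Reasoning
    union : S ∪ T ∪ U ≡ (S ∪ T) ∪ (T ∪ U)
    union = trans (cong (λ X → S ∪ X ∪ U) (sym (∪-idem T)))
      (trans (cong (S ∪_) (∪-assoc T T U)) (sym (∪-assoc S T (T ∪ U))))
    meet : T ∪ S ∩ U ≡ (S ∪ T) ∩ (T ∪ U)
    meet = trans (∪-distribˡ-∩ T S U) (cong (_∩ (T ∪ U)) (∪-comm T S))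

module _ where
  open import Data.Vec using ([]; _∷_)

  -- A partition of Fin n into k blocks is a colouring cs, and preimage cs S is the union of
  -- the blocks indexed by S; on such unions all set algebra is computation in Subset k.
  preimage : ∀ {k n} → Vec (Fin k) n → Subset k → Subset n
  preimage cs S = map (lookup S) cs

  preimage-∪ : ∀ {k n} (cs : Vec (Fin k) n) S T → preimage cs (S ∪ T) ≡ preimage cs S ∪ preimage cs T
  preimage-∪ []       S T = refl
  preimage-∪ (c ∷ cs) S T = cong₂ _∷_ (lookup-zipWith _∨_ c S T) (preimage-∪ cs S T)

  preimage-∩ : ∀ {k n} (cs : Vec (Fin k) n) S T → preimage cs (S ∩ T) ≡ preimage cs S ∩ preimage cs T
  preimage-∩ []       S T = refl
  preimage-∩ (c ∷ cs) S T = cong₂ _∷_ (lookup-zipWith _∧_ c S T) (preimage-∩ cs S T)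

  preimage-∁ : ∀ {k n} (cs : Vec (Fin k) n) S → preimage cs (∁ S) ≡ ∁ (preimage cs S)
  preimage-∁ []       S = refl
  preimage-∁ (c ∷ cs) S = cong₂ _∷_ (lookup-map c not S) (preimage-∁ cs S)

  preimage-⊤ : ∀ {k n} (cs : Vec (Fin k) n) → preimage cs ⊤ ≡ ⊤
  preimage-⊤ []       = refl
  preimage-⊤ (c ∷ cs) = cong₂ _∷_ (lookup-replicate c true) (preimage-⊤ cs)

  l a b r : Subset 4
  l = ⁅ zero ⁆
  a = ⁅ suc zero ⁆
  b = ⁅ suc (suc zero) ⁆
  r = ⁅ suc (suc (suc zero)) ⁆

  colour : ∀ x y z w → x ∧ y ≡ false → x ∧ z ≡ false → x ∧ w ≡ false → y ∧ z ≡ false →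
    y ∧ w ≡ false → z ∧ w ≡ false → x ∨ y ∨ z ∨ w ≡ true →
    Σ[ c ∈ Fin 4 ] (lookup l c ≡ x × lookup a c ≡ y × lookup b c ≡ z × lookup r c ≡ w)
  colour true  y     z     w     xy xz xw _  _  _  _     = zero , refl , sym xy , sym xz , sym xw
  colour false true  z     w     _  _  _  yz yw _  _     = suc zero , refl , refl , sym yz , sym yw
  colour false false true  w     _  _  _  _  _  zw _     = suc (suc zero) , refl , refl , refl , sym zw
  colour false false false w     _  _  _  _  _  _  cover = suc (suc (suc zero)) , refl , refl , refl , sym cover

  colouring : ∀ {n} {L A B R : Subset n} → Partition4 L A B R →
    Σ[ cs ∈ Vec (Fin 4) n ] (preimage cs l ≡ L × preimage cs a ≡ A × preimage cs b ≡ B × preimage cs r ≡ R)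
  colouring {L = []} {[]} {[]} {[]} _ = [] , refl , refl , refl , refl
  colouring {L = x ∷ L} {y ∷ A} {z ∷ B} {w ∷ R} (la , lb , lr , ab , ar , br , cover)
    with colour x y z w (∷-injectiveˡ la) (∷-injectiveˡ lb) (∷-injectiveˡ lr) (∷-injectiveˡ ab)
                        (∷-injectiveˡ ar) (∷-injectiveˡ br) (∷-injectiveˡ cover)
       | colouring (∷-injectiveʳ la , ∷-injectiveʳ lb , ∷-injectiveʳ lr , ∷-injectiveʳ ab ,
                    ∷-injectiveʳ ar , ∷-injectiveʳ br , ∷-injectiveʳ cover)
  ... | c , refl , refl , refl , refl | cs , refl , refl , refl , refl =
    c ∷ cs , refl , refl , refl , refl

  ∣∪∣-disjoint : ∀ {n} (X Y : Subset n) → X ∩ Y ≡ ⊥ → ∣ X ∪ Y ∣ ≡ ∣ X ∣ + ∣ Y ∣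
  ∣∪∣-disjoint []          []          _ = refl
  ∣∪∣-disjoint (true ∷ X)  (true ∷ Y)  ()
  ∣∪∣-disjoint (true ∷ X)  (false ∷ Y) p = cong suc (∣∪∣-disjoint X Y (∷-injectiveʳ p))
  ∣∪∣-disjoint (false ∷ X) (true ∷ Y)  p =
    trans (cong suc (∣∪∣-disjoint X Y (∷-injectiveʳ p))) (sym (+-suc ∣ X ∣ ∣ Y ∣))
  ∣∪∣-disjoint (false ∷ X) (false ∷ Y) p = ∣∪∣-disjoint X Y (∷-injectiveʳ p)

module FourBlockFlexipath (ρ : Subset 4 → ℕ)
  (ρ-mono : ∀ S T → ρ S ≤ ρ (S ∪ T))
  (ρ-submod : ∀ S T → ρ (S ∪ T) + ρ (S ∩ T) ≤ ρ S + ρ T)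
  (conn-l : conn ρ l ≡ 3) (conn-a : conn ρ a ≡ 3) (conn-b : conn ρ b ≡ 3)
  (conn-la : conn ρ (l ∪ a) ≡ 3) (conn-lb : conn ρ (l ∪ b) ≡ 3) (conn-lab : conn ρ (l ∪ a ∪ b) ≡ 3)
  (conn-ab : 3 < conn ρ (a ∪ b)) where

  open LocalConnectivity ρ ρ-mono ρ-submod
  open ≤-Reasoning

  private
    ⊓ : Subset 4 → Subset 4 → ℕ
    ⊓ = localConn ρ

  -- For concrete block sets, conn ρ S and ⊓ S (∁ S) agree definitionally, and so do unions
  -- listing the same blocks in different orders.
  conn-r : conn ρ r ≡ 3
  conn-r = trans (localConn-comm r (l ∪ a ∪ b)) conn-lab

  ⊓al≡⊓l[br] : ⊓ a l ≡ ⊓ l (b ∪ r)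
  ⊓al≡⊓l[br] = localConn-chain-cancel a l (b ∪ r) (trans conn-a (sym conn-la))

  ⊓bl≡⊓l[ar] : ⊓ b l ≡ ⊓ l (a ∪ r)
  ⊓bl≡⊓l[ar] = localConn-chain-cancel b l (a ∪ r) (trans conn-b (sym conn-lb))

  ⊓la≡⊓a[br] : ⊓ l a ≡ ⊓ a (b ∪ r)
  ⊓la≡⊓a[br] = localConn-chain-cancel l a (b ∪ r) (trans conn-l (sym conn-la))

  ⊓lb≡⊓b[ar] : ⊓ l b ≡ ⊓ b (a ∪ r)
  ⊓lb≡⊓b[ar] = localConn-chain-cancel l b (a ∪ r) (trans conn-l (sym conn-lb))

  ⊓[la]b≡⊓br : ⊓ (l ∪ a) b ≡ ⊓ b r
  ⊓[la]b≡⊓br = localConn-chain-cancel (l ∪ a) b r (trans conn-la (sym conn-lab))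

  ⊓lb≤⊓la : ⊓ l b ≤ ⊓ l a
  ⊓lb≤⊓la = begin
    ⊓ l b        ≤⟨ localConn-monoʳ l b r ⟩
    ⊓ l (b ∪ r)  ≡⟨ ⊓al≡⊓l[br] ⟨
    ⊓ a l        ≡⟨ localConn-comm a l ⟩
    ⊓ l a        ∎

  ⊓la≤⊓lb : ⊓ l a ≤ ⊓ l b
  ⊓la≤⊓lb = begin
    ⊓ l a        ≤⟨ localConn-monoʳ l a r ⟩
    ⊓ l (a ∪ r)  ≡⟨ ⊓bl≡⊓l[ar] ⟨
    ⊓ b l        ≡⟨ localConn-comm b l ⟩
    ⊓ l b        ∎

  ⊓la≡⊓lb : ⊓ l a ≡ ⊓ l b
  ⊓la≡⊓lb = ≤-antisym ⊓la≤⊓lb ⊓lb≤⊓la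

  conn[ab]≤3+⊓la+⊓lb : conn ρ (a ∪ b) ≤ 3 + (⊓ l a + ⊓ l b)
  conn[ab]≤3+⊓la+⊓lb = begin
    conn ρ (a ∪ b)                   ≡⟨ localConn-comm (l ∪ r) (a ∪ b) ⟨
    conn ρ (l ∪ r)                   ≤⟨ m≤n+m (conn ρ (l ∪ r)) (⊓ l r) ⟩
    ⊓ l r + conn ρ (l ∪ r)           ≡⟨ localConn-chain l r (a ∪ b) ⟩
    conn ρ l + ⊓ r (a ∪ b)           ≡⟨ cong₂ _+_ conn-l (localConn-comm r (a ∪ b)) ⟩
    3 + ⊓ (a ∪ b) r                  ≤⟨ +-monoʳ-≤ 3 (m≤n+m (⊓ (a ∪ b) r) (⊓ a b)) ⟩
    3 + (⊓ a b + ⊓ (a ∪ b) r)        ≡⟨ cong (3 +_) (localConn-chain a b r) ⟩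
    3 + (⊓ a (b ∪ r) + ⊓ b r)        ≤⟨ +-monoʳ-≤ 3 (+-monoʳ-≤ (⊓ a (b ∪ r)) (localConn-monoʳ b r a)) ⟩
    3 + (⊓ a (b ∪ r) + ⊓ b (a ∪ r))  ≡⟨ cong (3 +_) (cong₂ _+_ ⊓la≡⊓a[br] ⊓lb≡⊓b[ar]) ⟨
    3 + (⊓ l a + ⊓ l b)              ∎

  ⊓lb≤⊓br : ⊓ l b ≤ ⊓ b r
  ⊓lb≤⊓br = begin
    ⊓ l b        ≡⟨ localConn-comm l b ⟩
    ⊓ b l        ≤⟨ localConn-monoʳ b l a ⟩
    ⊓ b (l ∪ a)  ≡⟨ localConn-comm b (l ∪ a) ⟩
    ⊓ (l ∪ a) b  ≡⟨ ⊓[la]b≡⊓br ⟩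
    ⊓ b r        ∎

  ⊓ab+conn[ab]≤6 : ⊓ a b + conn ρ (a ∪ b) ≤ 6
  ⊓ab+conn[ab]≤6 = begin
    ⊓ a b + conn ρ (a ∪ b)  ≡⟨ localConn-chain a b (l ∪ r) ⟩
    conn ρ a + ⊓ b (l ∪ r)  ≤⟨ +-monoʳ-≤ (conn ρ a) (localConn-monoʳ b (l ∪ r) a) ⟩
    conn ρ a + conn ρ b     ≡⟨ cong₂ _+_ conn-a conn-b ⟩
    6                       ∎

  ⊓[ab]r≤3 : ⊓ (a ∪ b) r ≤ 3
  ⊓[ab]r≤3 = begin
    ⊓ (a ∪ b) r  ≡⟨ localConn-comm (a ∪ b) r ⟩
    ⊓ r (a ∪ b)  ≤⟨ localConn-monoʳ r (a ∪ b) l ⟩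
    conn ρ r     ≡⟨ conn-r ⟩
    3            ∎

  ⊓la+⊓lb+conn[ab]≤9 : ⊓ l a + ⊓ l b + conn ρ (a ∪ b) ≤ 9
  ⊓la+⊓lb+conn[ab]≤9 = begin
    ⊓ l a + ⊓ l b + conn ρ (a ∪ b)          ≤⟨ +-monoˡ-≤ (conn ρ (a ∪ b)) (+-monoʳ-≤ (⊓ l a) ⊓lb≤⊓br) ⟩
    ⊓ l a + ⊓ b r + conn ρ (a ∪ b)          ≡⟨ cong (λ x → x + ⊓ b r + conn ρ (a ∪ b)) ⊓la≡⊓a[br] ⟩
    ⊓ a (b ∪ r) + ⊓ b r + conn ρ (a ∪ b)    ≡⟨ cong (_+ conn ρ (a ∪ b)) (localConn-chain a b r) ⟨
    ⊓ a b + ⊓ (a ∪ b) r + conn ρ (a ∪ b)    ≡⟨ xy∙z≈xz∙y (⊓ a b) (⊓ (a ∪ b) r) (conn ρ (a ∪ b)) ⟩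
    ⊓ a b + conn ρ (a ∪ b) + ⊓ (a ∪ b) r    ≤⟨ +-mono-≤ ⊓ab+conn[ab]≤6 ⊓[ab]r≤3 ⟩
    9                                       ∎

  ⊓la≡2⊎⊓la≡1 : ⊓ l a ≡ 2 ⊎ ⊓ l a ≡ 1
  ⊓la≡2⊎⊓la≡1 = between (⊓ l a) lower upper
    where
    lower : 4 ≤ 3 + (⊓ l a + ⊓ l a)
    lower = ≤-trans conn-ab (subst (λ x → conn ρ (a ∪ b) ≤ 3 + (⊓ l a + x)) (sym ⊓la≡⊓lb) conn[ab]≤3+⊓la+⊓lb)
    upper : ⊓ l a + ⊓ l a + 4 ≤ 9
    upper = ≤-trans (+-monoʳ-≤ (⊓ l a + ⊓ l a) conn-ab)
      (subst (λ x → ⊓ l a + x + conn ρ (a ∪ b) ≤ 9) (sym ⊓la≡⊓lb) ⊓la+⊓lb+conn[ab]≤9)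
    between : ∀ m → 4 ≤ 3 + (m + m) → m + m + 4 ≤ 9 → m ≡ 2 ⊎ m ≡ 1
    between 0 (s≤s (s≤s (s≤s ()))) _
    between 1 _ _ = inj₂ refl
    between 2 _ _ = inj₁ refl
    between (suc (suc (suc m))) _ h =
      contradiction h (<⇒≱ (+-monoˡ-≤ 4 (+-mono-≤ (m≤m+n 3 m) (m≤m+n 3 m))))

module _ {n : ℕ} (M : Matroid n) where
  open BooleanAlgebraProperties (∪-∩-booleanAlgebra n) using (¬-involutive; ¬⊤≈⊥)

  private
    rk : Subset n → ℕ
    rk = rank M

  rank-∪-mono : ∀ X Y → rk X ≤ rk (X ∪ Y)
  rank-∪-mono X Y = rank-mono M (p⊆p∪q Y)

  open LocalConnectivity rk rank-∪-mono (rank-sub M)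

  dualRank-+ : ∀ X → dualRank rk X + rk ⊤ ≡ ∣ X ∣ + rk (∁ X)
  dualRank-+ X = m∸n+n≡m (begin
    rk ⊤                 ≤⟨ m≤n+m (rk ⊤) (conn rk X) ⟩
    conn rk X + rk ⊤     ≡⟨ conn-+ X ⟩
    rk X + rk (∁ X)      ≤⟨ +-monoˡ-≤ (rk (∁ X)) (rank-card M X) ⟩
    ∣ X ∣ + rk (∁ X)     ∎)
    where open ≤-Reasoning

  conn+∣∣ : ∀ X → conn rk X + ∣ X ∣ ≡ rk X + dualRank rk X
  conn+∣∣ X = +-cancelʳ-≡ (rk ⊤) _ _ (begin
    conn rk X + ∣ X ∣ + rk ⊤         ≡⟨ xy∙z≈xz∙y (conn rk X) ∣ X ∣ (rk ⊤) ⟩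
    conn rk X + rk ⊤ + ∣ X ∣         ≡⟨ cong (_+ ∣ X ∣) (conn-+ X) ⟩
    rk X + rk (∁ X) + ∣ X ∣          ≡⟨ +-assoc (rk X) (rk (∁ X)) ∣ X ∣ ⟩
    rk X + (rk (∁ X) + ∣ X ∣)        ≡⟨ cong (rk X +_) (trans (+-comm (rk (∁ X)) ∣ X ∣) (sym (dualRank-+ X))) ⟩
    rk X + (dualRank rk X + rk ⊤)    ≡⟨ +-assoc (rk X) (dualRank rk X) (rk ⊤) ⟨
    rk X + dualRank rk X + rk ⊤      ∎)
    where open ≡-Reasoning

  localConn-dual : ∀ {X Y k} → X ∩ Y ≡ ⊥ →
    localConn rk X Y + k + conn rk (X ∪ Y) ≡ conn rk X + conn rk Y → localConn (dualRank rk) X Y ≡ k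
  localConn-dual {X} {Y} {k} disjoint sum =
    trans (cong (_∸ dualRank rk (X ∪ Y)) (dual-arithmetic
      (rk X) (rk Y) (rk (X ∪ Y)) (dualRank rk X) (dualRank rk Y) (dualRank rk (X ∪ Y))
      (conn rk X) (conn rk Y) (conn rk (X ∪ Y)) ∣ X ∣ ∣ Y ∣
      (localConn-+ X Y) (conn+∣∣ X) (conn+∣∣ Y)
      (subst (λ c → conn rk (X ∪ Y) + c ≡ rk (X ∪ Y) + dualRank rk (X ∪ Y))
        (∣∪∣-disjoint X Y disjoint) (conn+∣∣ (X ∪ Y)))
      sum))
      (m+n∸n≡m k (dualRank rk (X ∪ Y)))

  dualRank-involutive : ∀ X → dualRank (dualRank rk) X ≡ rk X
  dualRank-involutive X = trans (cong (_∸ dualRank rk ⊤) complement) (m+n∸n≡m (rk X) (dualRank rk ⊤))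
    where
    open ≡-Reasoning
    ∣⊤∣+rk∁⊤≡n : ∣ ⊤ {n = n} ∣ + rk (∁ ⊤) ≡ n
    ∣⊤∣+rk∁⊤≡n = begin
      ∣ ⊤ {n = n} ∣ + rk (∁ ⊤)  ≡⟨ cong₂ _+_ (∣⊤∣≡n n) (cong rk ¬⊤≈⊥) ⟩
      n + rk ⊥                  ≡⟨ cong (n +_) (n≤0⇒n≡0 (subst (rk ⊥ ≤_) (∣⊥∣≡0 n) (rank-card M ⊥))) ⟩
      n + 0                     ≡⟨ +-identityʳ n ⟩
      n                         ∎
    complement : ∣ X ∣ + dualRank rk (∁ X) ≡ rk X + dualRank rk ⊤
    complement = +-cancelʳ-≡ (rk ⊤) _ _ (begin
      ∣ X ∣ + dualRank rk (∁ X) + rk ⊤      ≡⟨ +-assoc ∣ X ∣ (dualRank rk (∁ X)) (rk ⊤) ⟩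
      ∣ X ∣ + (dualRank rk (∁ X) + rk ⊤)    ≡⟨ cong (∣ X ∣ +_) (dualRank-+ (∁ X)) ⟩
      ∣ X ∣ + (∣ ∁ X ∣ + rk (∁ (∁ X)))      ≡⟨ cong (λ Z → ∣ X ∣ + (∣ ∁ X ∣ + rk Z)) (¬-involutive X) ⟩
      ∣ X ∣ + (∣ ∁ X ∣ + rk X)              ≡⟨ +-assoc ∣ X ∣ ∣ ∁ X ∣ (rk X) ⟨
      ∣ X ∣ + ∣ ∁ X ∣ + rk X                ≡⟨ cong (_+ rk X) (trans (cong (∣ X ∣ +_) (∣∁p∣≡n∸∣p∣ X)) (m+[n∸m]≡n (∣p∣≤n X))) ⟩
      n + rk X                              ≡⟨ +-comm n (rk X) ⟩
      rk X + n                              ≡⟨ cong (rk X +_) (sym (trans (dualRank-+ ⊤) ∣⊤∣+rk∁⊤≡n)) ⟩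
      rk X + (dualRank rk ⊤ + rk ⊤)         ≡⟨ +-assoc (rk X) (dualRank rk ⊤) (rk ⊤) ⟨
      rk X + dualRank rk ⊤ + rk ⊤           ∎)

  localConn-dualRank-involutive : ∀ X Y → localConn (dualRank (dualRank rk)) X Y ≡ localConn rk X Y
  localConn-dualRank-involutive X Y =
    cong₂ _∸_ (cong₂ _+_ (dualRank-involutive X) (dualRank-involutive Y)) (dualRank-involutive (X ∪ Y))

  localConn≡2⇒Pair21 : ∀ {X Y} → X ∩ Y ≡ ⊥ → conn rk X ≡ 3 → conn rk Y ≡ 3 → conn rk (X ∪ Y) ≡ 3 →
    localConn rk X Y ≡ 2 → Pair21 rk X Y
  localConn≡2⇒Pair21 disjoint cX cY cXY ⊓≡2 =
    ⊓≡2 , localConn-dual disjoint (trans (cong₂ (λ p c → p + 1 + c) ⊓≡2 cXY) (sym (cong₂ _+_ cX cY)))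

  localConn≡1⇒Pair21-dual : ∀ {X Y} → X ∩ Y ≡ ⊥ → conn rk X ≡ 3 → conn rk Y ≡ 3 → conn rk (X ∪ Y) ≡ 3 →
    localConn rk X Y ≡ 1 → Pair21 (dualRank rk) X Y
  localConn≡1⇒Pair21-dual {X} {Y} disjoint cX cY cXY ⊓≡1 =
    localConn-dual disjoint (trans (cong₂ (λ p c → p + 2 + c) ⊓≡1 cXY) (sym (cong₂ _+_ cX cY))) ,
    trans (localConn-dualRank-involutive X Y) ⊓≡1

module _ {k n : ℕ} (M : Matroid n) (cs : Vec (Fin k) n) where

  blockRank : Subset k → ℕ
  blockRank S = rank M (preimage cs S)

  blockRank-mono : ∀ S T → blockRank S ≤ blockRank (S ∪ T)
  blockRank-mono S T = subst (λ X → blockRank S ≤ rank M X) (sym (preimage-∪ cs S T))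
    (rank-∪-mono M (preimage cs S) (preimage cs T))

  blockRank-submod : ∀ S T → blockRank (S ∪ T) + blockRank (S ∩ T) ≤ blockRank S + blockRank T
  blockRank-submod S T = subst₂ (λ X Y → rank M X + rank M Y ≤ blockRank S + blockRank T)
    (sym (preimage-∪ cs S T)) (sym (preimage-∩ cs S T)) (rank-sub M (preimage cs S) (preimage cs T))

  conn-blockRank : ∀ S {X} → preimage cs S ≡ X → conn blockRank S ≡ conn (rank M) X
  conn-blockRank S refl =
    cong₂ (λ X Y → (blockRank S + rank M X) ∸ rank M Y) (preimage-∁ cs S) (preimage-⊤ cs)

  localConn-blockRank : ∀ S T → localConn blockRank S T ≡ localConn (rank M) (preimage cs S) (preimage cs T)
  localConn-blockRank S T = cong (λ X → (blockRank S + blockRank T) ∸ rank M X) (preimage-∪ cs S T)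

lemma4p12 : ∀ {n} (M : Matroid n) (L Q₁ Q₂ R : Subset n)
    → FlexiPath4c 3 M L Q₁ Q₂ R
    → (Pair21 (rank M) L Q₁ × Pair21 (rank M) L Q₂)
    ⊎ (Pair21 (dualRank (rank M)) L Q₁ × Pair21 (dualRank (rank M)) L Q₂)
lemma4p12 M L Q₁ Q₂ R
  (((partition@(L∩Q₁≡⊥ , L∩Q₂≡⊥ , _) , _ , cL , cLQ₁ , cLQ₁Q₂) , (_ , _ , _ , cLQ₂ , _)) , cQ₁ , cQ₂ , cQ₁Q₂)
  with colouring partition
... | cs , refl , refl , refl , refl =
  Sum.map
    (λ α≡2 → localConn≡2⇒Pair21 M L∩Q₁≡⊥ cL cQ₁ cLQ₁ (trans ⊓LQ₁≡α α≡2)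
           , localConn≡2⇒Pair21 M L∩Q₂≡⊥ cL cQ₂ cLQ₂ (trans ⊓LQ₂≡α α≡2))
    (λ α≡1 → localConn≡1⇒Pair21-dual M L∩Q₁≡⊥ cL cQ₁ cLQ₁ (trans ⊓LQ₁≡α α≡1)
           , localConn≡1⇒Pair21-dual M L∩Q₂≡⊥ cL cQ₂ cLQ₂ (trans ⊓LQ₂≡α α≡1))
    ⊓la≡2⊎⊓la≡1
  where
  via : ∀ S {X} → preimage cs S ≡ X → conn (rank M) X ≡ 3 → conn (blockRank M cs) S ≡ 3
  via S eq c = trans (conn-blockRank M cs S eq) c
  open FourBlockFlexipath (blockRank M cs) (blockRank-mono M cs) (blockRank-submod M cs)
    (via l refl cL) (via a refl cQ₁) (via b refl cQ₂)
    (via (l ∪ a) (preimage-∪ cs l a) cLQ₁) (via (l ∪ b) (preimage-∪ cs l b) cLQ₂)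
    (via (l ∪ a ∪ b) (trans (preimage-∪ cs l (a ∪ b)) (cong (preimage cs l ∪_) (preimage-∪ cs a b))) cLQ₁Q₂)
    (subst (3 <_) (sym (conn-blockRank M cs (a ∪ b) (preimage-∪ cs a b))) cQ₁Q₂)
  ⊓LQ₁≡α : localConn (rank M) (preimage cs l) (preimage cs a) ≡ localConn (blockRank M cs) l a
  ⊓LQ₁≡α = sym (localConn-blockRank M cs l a)
  ⊓LQ₂≡α : localConn (rank M) (preimage cs l) (preimage cs b) ≡ localConn (blockRank M cs) l a
  ⊓LQ₂≡α = trans (sym (localConn-blockRank M cs l b)) (sym ⊓la≡⊓lb)
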